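{- Let $m\geq 3$ and let $G=S(2,1^{m-1})$ be the starlike tree of order $m+2$ (the tree on vertices $o,x_1,\dots,x_m,y$ with edges $ox_1,\dots,ox_m,x_1y$). Then $$b(G)=\begin{cases}\frac{m^2}{2}-1 & \text{if } m \text{ is even},\\ \binom{m+1}{2} & \text{if } m \text{ is odd}.\end{cases}$$
   Context: All graphs are finite and simple. For vertices $u,v$ of a graph $G$, $d_G(u,v)$ is the length of a shortest $u$–$v$ path. For an edge $xy$ of $G$, $W^G_{xy}=\{u\in V(G): d_G(u,x)<d_G(u,y)\}$. A graph is distance-balanced if $|W^G_{xy}|=|W^G_{yx}|$ for every edge $xy$. For a graph $H$, $b(H)$ is the smallest number of edges which can be added to $H$ (keeping the vertex set) so that the resulting graph is distance-balanced. A starlike tree is a tree with exactly one vertex of degree greater than two; $S(n_1^{\alpha_1},\dots,n_k^{\alpha_k})$ denotes the starlike tree in which deleting the central vertex leaves $\alpha_i$ paths with $n_i$ vertices for each $i$. -}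

module Defs where

open import Data.Nat using (ℕ; zero; suc; _+_; _∸_; _≤_; _<ᵇ_; _≡ᵇ_; _≤ᵇ_)
open import Data.Bool using (Bool; true; false; _∧_; _∨_; if_then_else_; not)
open import Data.Fin using (Fin; toℕ)
open import Data.List using (List; map; concatMap)
open import Data.Nat.ListAction using (sum)
open import Data.Bool.ListAction using (any)
open import Data.List.Base using (allFin)
open import Data.Product using (Σ; _×_)
open import Relation.Binary.PropositionalEquality using (_≡_)

Adj : ℕ → Set
Adj n = Fin n → Fin n → Bool

IsSimple : {n : ℕ} → Adj n → Set
IsSimple {n} A = (∀ i j → A i j ≡ A j i) × (∀ i → A i i ≡ false)

_⊆G_ : {n : ℕ} → Adj n → Adj n → Set
G ⊆G H = ∀ i j → G i j ≡ true → H i j ≡ true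

countV : {n : ℕ} → (Fin n → Bool) → ℕ
countV {n} p = sum (map (λ i → if p i then 1 else 0) (allFin n))

edgeCount : {n : ℕ} → Adj n → ℕ
edgeCount {n} A =
  sum (concatMap (λ i → map (λ j → if (toℕ i <ᵇ toℕ j) ∧ A i j then 1 else 0) (allFin n)) (allFin n))

reach : {n : ℕ} → Adj n → ℕ → Fin n → Fin n → Bool
reach A zero    u v = toℕ u ≡ᵇ toℕ v
reach A (suc k) u v = reach A k u v ∨ any (λ w → reach A k u w ∧ A w v) (allFin _)

firstTrue : ℕ → (ℕ → Bool) → ℕ → ℕ
firstTrue zero     p k = k
firstTrue (suc f)  p k = if p k then k else firstTrue f p (suc k)

-- d_G(u,v): length of a shortest u–v path (the least k such that a walk of
-- length ≤ k exists). Convention for unreachable pairs: n (never used, since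
-- all graphs considered are connected).
dist : {n : ℕ} → Adj n → Fin n → Fin n → ℕ
dist {n} A u v = firstTrue n (λ k → reach A k u v) 0

Wcard : {n : ℕ} → Adj n → Fin n → Fin n → ℕ
Wcard A x y = countV (λ u → dist A u x <ᵇ dist A u y)

DistanceBalanced : {n : ℕ} → Adj n → Set
DistanceBalanced A = ∀ x y → A x y ≡ true → Wcard A x y ≡ Wcard A y x

IsB : {n : ℕ} → Adj n → ℕ → Set
IsB {n} G k =
  (Σ (Adj n) λ H → IsSimple H × G ⊆G H × DistanceBalanced H × (edgeCount H ∸ edgeCount G ≡ k))
  × (∀ (H : Adj n) → IsSimple H → G ⊆G H → DistanceBalanced H → k ≤ edgeCount H ∸ edgeCount G)

-- S(2,1^{m-1}) on Fin (m+2): o = 0, x_i = i (1 ≤ i ≤ m), y = m+1;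
-- edges o x_i (1 ≤ i ≤ m) and x_1 y.
starE : ℕ → ℕ → ℕ → Bool
starE m a b = ((a ≡ᵇ 0) ∧ (1 ≤ᵇ b) ∧ (b ≤ᵇ m)) ∨ ((a ≡ᵇ 1) ∧ (b ≡ᵇ suc m))

S21 : (m : ℕ) → Adj (m + 2)
S21 m i j = starE m (toℕ i) (toℕ j) ∨ starE m (toℕ j) (toℕ i)

-- Let H ⊇ G be simple and distance-balanced. In a distance-balanced graph a vertex o adjacent to
-- all others forces completeness: for v ≠ o every vertex but v is adjacent to o, so |W_vo| ≤ 1,
-- hence |W_ov| ≤ 1 and v is adjacent to everything. So if o ~ y then H = K_{m+2}. Otherwise no
-- vertex is universal, and balancing the edges o x_i and x_1 y forces every x_i to be adjacent to y
-- and to all but exactly one other x_j; thus H is m-regular. By the handshake lemma 2|E(H)| is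
-- (m+2)(m+1) or (m+2)m, the latter being odd for odd m. Both values are attained: by K_{m+2}, and
-- for even m by K_{m+2} minus the perfect matching i ↔ m+1−i.

module Submission where

open import Defs
open import Data.Nat
  using (ℕ; zero; suc; _+_; _*_; _∸_; _≤_; _<_; _<ᵇ_; _≡ᵇ_; _≤ᵇ_; z≤n; s≤s; s≤s⁻¹; _≤?_; _/_; _%_)
open import Data.Nat.Combinatorics using (_C_; nC1≡n; nCk+nC[k+1]≡[n+1]C[k+1])
open import Data.Nat.DivMod using (m≡m%n+[m/n]*n; m*n/n≡m)
open import Data.Nat.Solver using (module +-*-Solver)
open +-*-Solver using (solve; _:+_; _:*_; _:=_; con)
open import Data.Nat.Properties hiding (_≟_)
import Data.Nat.Properties as ℕ
open import Data.Bool using (Bool; true; false; _∧_; _∨_; if_then_else_; not)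
open import Data.Bool.Properties using (¬-not; T-≡; ∨-zeroʳ; ∧-zeroʳ; ∨-comm; ∨-identityʳ)
import Data.Bool.Properties as Bool
open import Data.Fin using (Fin; toℕ; zero; suc; fromℕ<)
open import Data.Fin.Properties using (toℕ-injective; toℕ<n; toℕ-fromℕ<; _≟_; any?)
open import Data.List using (List; []; _∷_; map; concatMap; tabulate; allFin)
open import Data.List.Relation.Unary.Any.Properties using (any⁺; any⁻; tabulate⁺; tabulate⁻)
open import Data.Nat.ListAction using (sum)
open import Data.Nat.ListAction.Properties using (sum-++)
open import Data.Bool.ListAction using (any)
open import Data.Product using (∃; _×_; _,_; proj₁; proj₂)
open import Data.Sum using (_⊎_; inj₁; inj₂; [_,_]′)
open import Data.Empty using (⊥; ⊥-elim)
open import Function using (_∘_; Equivalence)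
open import Relation.Nullary using (yes; no; contradiction)
open import Relation.Nullary.Decidable using (decidable-stable; ¬?; _×-dec_)
open import Relation.Binary.PropositionalEquality
open import Relation.Binary.Definitions using (tri<; tri≈; tri>)
open import Algebra.Properties.CommutativeSemigroup +-commutativeSemigroup using (interchange)

private
  variable
    n : ℕ

≡true⇒≢false : ∀ {b} → b ≡ true → b ≢ false
≡true⇒≢false refl ()

∧-trueˡ : ∀ {a b} → (a ∧ b) ≡ true → a ≡ true
∧-trueˡ {true} _ = refl

∧-trueʳ : ∀ {a b} → (a ∧ b) ≡ true → b ≡ true
∧-trueʳ {true} e = e

∨-true : ∀ {a b} → (a ∨ b) ≡ true → a ≡ true ⊎ b ≡ true
∨-true {true} _ = inj₁ refl
∨-true {false} e = inj₂ e

not-true : ∀ {b} → not b ≡ true → b ≡ false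
not-true {false} _ = refl

not-false : ∀ {b} → not b ≡ false → b ≡ true
not-false {true} _ = refl

≡ᵇ-true⇒≡ : ∀ {a b} → (a ≡ᵇ b) ≡ true → a ≡ b
≡ᵇ-true⇒≡ {a} {b} e = ≡ᵇ⇒≡ a b (Equivalence.from T-≡ e)

≡⇒≡ᵇ-true : ∀ {a b} → a ≡ b → (a ≡ᵇ b) ≡ true
≡⇒≡ᵇ-true {a} {b} e = Equivalence.to T-≡ (≡⇒≡ᵇ a b e)

≢⇒≡ᵇ-false : ∀ {a b} → a ≢ b → (a ≡ᵇ b) ≡ false
≢⇒≡ᵇ-false a≢b = ¬-not (a≢b ∘ ≡ᵇ-true⇒≡)

<⇒<ᵇ-true : ∀ {a b} → a < b → (a <ᵇ b) ≡ true
<⇒<ᵇ-true a<b = Equivalence.to T-≡ (<⇒<ᵇ a<b)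

≥⇒<ᵇ-false : ∀ {a b} → b ≤ a → (a <ᵇ b) ≡ false
≥⇒<ᵇ-false {a} {b} b≤a = ¬-not (λ e → <⇒≱ (<ᵇ⇒< a b (Equivalence.from T-≡ e)) b≤a)

≤⇒≤ᵇ-true : ∀ {a b} → a ≤ b → (a ≤ᵇ b) ≡ true
≤⇒≤ᵇ-true a≤b = Equivalence.to T-≡ (≤⇒≤ᵇ a≤b)

≤ᵇ-true⇒≤ : ∀ {a b} → (a ≤ᵇ b) ≡ true → a ≤ b
≤ᵇ-true⇒≤ {a} {b} e = ≤ᵇ⇒≤ a b (Equivalence.from T-≡ e)

-- reach A 0 u v reduces to u == v.
infix 4 _==_
_==_ : Fin n → Fin n → Bool
u == v = toℕ u ≡ᵇ toℕ v

==-true⇒≡ : {u v : Fin n} → (u == v) ≡ true → u ≡ v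
==-true⇒≡ = toℕ-injective ∘ ≡ᵇ-true⇒≡

==-refl : (u : Fin n) → (u == u) ≡ true
==-refl u = ≡⇒≡ᵇ-true {toℕ u} refl

≢⇒==-false : {u v : Fin n} → u ≢ v → (u == v) ≡ false
≢⇒==-false u≢v = ≢⇒≡ᵇ-false (u≢v ∘ toℕ-injective)

==-sym : (u v : Fin n) → (u == v) ≡ (v == u)
==-sym u v with u ≟ v
... | yes refl = refl
... | no u≢v = trans (≢⇒==-false u≢v) (sym (≢⇒==-false (u≢v ∘ sym)))

distinct⇒1<n : {u v : Fin n} → u ≢ v → 1 < n
distinct⇒1<n {suc (suc n)} _ = s≤s (s≤s z≤n)
distinct⇒1<n {suc zero} {zero} {zero} u≢v = contradiction refl u≢v

sumF : (Fin n → ℕ) → ℕ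
sumF {zero} f = 0
sumF {suc n} f = f zero + sumF (f ∘ suc)

sumF-cong : {f g : Fin n → ℕ} → (∀ i → f i ≡ g i) → sumF f ≡ sumF g
sumF-cong {zero} _ = refl
sumF-cong {suc n} f≗g = cong₂ _+_ (f≗g zero) (sumF-cong (f≗g ∘ suc))

sumF-mono : {f g : Fin n → ℕ} → (∀ i → f i ≤ g i) → sumF f ≤ sumF g
sumF-mono {zero} _ = z≤n
sumF-mono {suc n} f≤g = +-mono-≤ (f≤g zero) (sumF-mono (f≤g ∘ suc))

sumF-+ : (f g : Fin n → ℕ) → sumF (λ i → f i + g i) ≡ sumF f + sumF g
sumF-+ {zero} f g = refl
sumF-+ {suc n} f g = trans (cong (f zero + g zero +_) (sumF-+ (f ∘ suc) (g ∘ suc)))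
                           (interchange (f zero) (g zero) _ _)

sumF-const : ∀ c → sumF {n} (λ _ → c) ≡ n * c
sumF-const {zero} c = refl
sumF-const {suc n} c = cong (c +_) (sumF-const {n} c)

sumF-swap : (f : Fin n → Fin n → ℕ) → sumF (λ i → sumF (f i)) ≡ sumF (λ j → sumF (λ i → f i j))
sumF-swap {zero} f = refl
sumF-swap {suc n} f = begin
    (f zero zero + row) + sumF (λ i → f (suc i) zero + sumF (f (suc i) ∘ suc))
  ≡⟨ cong (f zero zero + row +_) (sumF-+ (λ i → f (suc i) zero) (λ i → sumF (f (suc i) ∘ suc))) ⟩
    (f zero zero + row) + (column + sumF (λ i → sumF (f (suc i) ∘ suc)))
  ≡⟨ cong (λ s → f zero zero + row + (column + s)) (sumF-swap (λ i j → f (suc i) (suc j))) ⟩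
    (f zero zero + row) + (column + rest)
  ≡⟨ interchange (f zero zero) row column rest ⟩
    (f zero zero + column) + (row + rest)
  ≡⟨ cong (f zero zero + column +_) (sumF-+ (f zero ∘ suc) (λ j → sumF (λ i → f (suc i) (suc j)))) ⟨
    (f zero zero + column) + sumF (λ j → f zero (suc j) + sumF (λ i → f (suc i) (suc j)))
  ∎
  where
  open ≡-Reasoning
  row column rest : ℕ
  row = sumF (f zero ∘ suc)
  column = sumF (λ i → f (suc i) zero)
  rest = sumF (λ j → sumF (λ i → f (suc i) (suc j)))

sum-map-tabulate : ∀ {A : Set} (f : Fin n → A) (g : A → ℕ) → sum (map g (tabulate f)) ≡ sumF (g ∘ f)
sum-map-tabulate {zero} f g = refl
sum-map-tabulate {suc n} f g = cong (g (f zero) +_) (sum-map-tabulate (f ∘ suc) g)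

sum-concatMap : ∀ {A : Set} (h : A → List ℕ) xs → sum (concatMap h xs) ≡ sum (map (sum ∘ h) xs)
sum-concatMap h [] = refl
sum-concatMap h (x ∷ xs) = trans (sum-++ (h x) (concatMap h xs)) (cong (sum (h x) +_) (sum-concatMap h xs))

indicator : Bool → ℕ
indicator b = if b then 1 else 0

count : (Fin n → Bool) → ℕ
count p = sumF (indicator ∘ p)

countV≡count : (p : Fin n → Bool) → countV p ≡ count p
countV≡count p = sum-map-tabulate (λ i → i) (indicator ∘ p)

count-mono : {p q : Fin n → Bool} → (∀ u → p u ≡ true → q u ≡ true) → count p ≤ count q
count-mono {p = p} {q} p⊆q = sumF-mono (λ u → indicator-mono (p⊆q u))
  where
  indicator-mono : ∀ {a b} → (a ≡ true → b ≡ true) → indicator a ≤ indicator b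
  indicator-mono {false} _ = z≤n
  indicator-mono {true} a⇒b rewrite a⇒b refl = ≤-refl

count-false : {p : Fin n → Bool} → (∀ u → p u ≡ false) → count p ≡ 0
count-false {n} p≡false = trans (sumF-cong (cong indicator ∘ p≡false)) (trans (sumF-const {n} 0) (*-zeroʳ n))

count-complement : (p : Fin n → Bool) → count p + count (not ∘ p) ≡ n
count-complement {n} p = begin
    count p + count (not ∘ p)
  ≡⟨ sumF-+ (indicator ∘ p) (indicator ∘ not ∘ p) ⟨
    sumF (λ u → indicator (p u) + indicator (not (p u)))
  ≡⟨ sumF-cong (λ u → indicator-+-not (p u)) ⟩
    sumF {n} (λ _ → 1)
  ≡⟨ trans (sumF-const {n} 1) (*-identityʳ n) ⟩
    n
  ∎
  where
  open ≡-Reasoning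
  indicator-+-not : ∀ b → indicator b + indicator (not b) ≡ 1
  indicator-+-not true = refl
  indicator-+-not false = refl

count-∨-≤ : (p q : Fin n → Bool) → count (λ u → p u ∨ q u) ≤ count p + count q
count-∨-≤ p q =
  ≤-trans (sumF-mono (λ u → indicator-∨ (p u) (q u))) (≤-reflexive (sumF-+ (indicator ∘ p) (indicator ∘ q)))
  where
  indicator-∨ : ∀ a b → indicator (a ∨ b) ≤ indicator a + indicator b
  indicator-∨ true b = s≤s z≤n
  indicator-∨ false b = ≤-refl

count-∨-disjoint : (p q : Fin n → Bool) → (∀ u → p u ≡ true → q u ≡ false) →
                   count (λ u → p u ∨ q u) ≡ count p + count q
count-∨-disjoint p q disjoint =
  trans (sumF-cong (λ u → indicator-∨ (disjoint u))) (sumF-+ (indicator ∘ p) (indicator ∘ q))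
  where
  indicator-∨ : ∀ {a b} → (a ≡ true → b ≡ false) → indicator (a ∨ b) ≡ indicator a + indicator b
  indicator-∨ {true} a⇒¬b rewrite a⇒¬b refl = refl
  indicator-∨ {false} _ = refl

count-singleton : (v : Fin n) → count (_== v) ≡ 1
count-singleton {suc n} zero = cong suc (count-false {n} (λ _ → refl))
count-singleton {suc n} (suc v) = count-singleton v

==-subst : (p : Fin n → Bool) {b : Bool} {u : Fin n} (w : Fin n) → p u ≡ b → (w == u) ≡ true → p w ≡ b
==-subst p {b} w pu w==u = subst (λ x → p x ≡ b) (sym (==-true⇒≡ {u = w} w==u)) pu

count-pair : {u v : Fin n} → u ≢ v → count (λ w → (w == u) ∨ (w == v)) ≡ 2
count-pair {u = u} {v} u≢v =
  trans (count-∨-disjoint (_== u) (_== v) disjoint) (cong₂ _+_ (count-singleton u) (count-singleton v))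
  where
  disjoint : ∀ w → (w == u) ≡ true → (w == v) ≡ false
  disjoint w = ==-subst (_== v) w (≢⇒==-false u≢v)

count≤1 : {p : Fin n → Bool} (a : Fin n) → (∀ u → p u ≡ true → u ≡ a) → count p ≤ 1
count≤1 a p⊆a = ≤-trans (count-mono (λ u pu → ≡⇒== (p⊆a u pu))) (≤-reflexive (count-singleton a))
  where
  ≡⇒== : ∀ {u} → u ≡ a → (u == a) ≡ true
  ≡⇒== refl = ==-refl a

count≤2 : {p : Fin n → Bool} (a b : Fin n) → (∀ u → p u ≡ true → u ≡ a ⊎ u ≡ b) → count p ≤ 2
count≤2 a b p⊆ab = begin
    _                                ≤⟨ count-mono (λ u pu → ≡⇒== (p⊆ab u pu)) ⟩
    count (λ w → (w == a) ∨ (w == b)) ≤⟨ count-∨-≤ (_== a) (_== b) ⟩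
    count (_== a) + count (_== b)     ≡⟨ cong₂ _+_ (count-singleton a) (count-singleton b) ⟩
    2                                 ∎
  where
  open ≤-Reasoning
  ≡⇒== : ∀ {u} → u ≡ a ⊎ u ≡ b → ((u == a) ∨ (u == b)) ≡ true
  ≡⇒== (inj₁ refl) rewrite ==-refl a = refl
  ≡⇒== (inj₂ refl) rewrite ==-refl b = ∨-zeroʳ (b == a)

count≥1 : {p : Fin n → Bool} (u : Fin n) → p u ≡ true → 1 ≤ count p
count≥1 {p = p} u pu = ≤-trans (≤-reflexive (sym (count-singleton u))) (count-mono (λ w → ==-subst p w pu))

count≥2 : {p : Fin n → Bool} (u v : Fin n) → p u ≡ true → p v ≡ true → u ≢ v → 2 ≤ count p
count≥2 {p = p} u v pu pv u≢v = ≤-trans (≤-reflexive (sym (count-pair u≢v))) (count-mono uv⊆p)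
  where
  uv⊆p : ∀ w → ((w == u) ∨ (w == v)) ≡ true → p w ≡ true
  uv⊆p w e with ∨-true {w == u} e
  ... | inj₁ w==u = ==-subst p w pu w==u
  ... | inj₂ w==v = ==-subst p w pv w==v

count≥3 : {p : Fin n → Bool} (u v w : Fin n) → p u ≡ true → p v ≡ true → p w ≡ true →
          u ≢ v → u ≢ w → v ≢ w → 3 ≤ count p
count≥3 {p = p} u v w pu pv pw u≢v u≢w v≢w = begin
    3                                     ≡⟨ cong₂ _+_ (count-pair u≢v) (count-singleton w) ⟨
    count uv + count (_== w)              ≡⟨ count-∨-disjoint uv (_== w) disjoint ⟨
    count (λ x → uv x ∨ (x == w))         ≤⟨ count-mono uvw⊆p ⟩
    count p                               ∎
  where
  open ≤-Reasoning
  uv : Fin _ → Bool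
  uv x = (x == u) ∨ (x == v)
  disjoint : ∀ x → uv x ≡ true → (x == w) ≡ false
  disjoint x e with ∨-true {x == u} e
  ... | inj₁ x==u = ==-subst (_== w) x (≢⇒==-false u≢w) x==u
  ... | inj₂ x==v = ==-subst (_== w) x (≢⇒==-false v≢w) x==v
  uvw⊆p : ∀ x → (uv x ∨ (x == w)) ≡ true → p x ≡ true
  uvw⊆p x e with ∨-true {uv x} e
  ... | inj₂ x==w = ==-subst p x pw x==w
  ... | inj₁ e′ with ∨-true {x == u} e′
  ...   | inj₁ x==u = ==-subst p x pu x==u
  ...   | inj₂ x==v = ==-subst p x pv x==v

any-allFin⁺ : (p : Fin n → Bool) (w : Fin n) → p w ≡ true → any p (allFin n) ≡ true
any-allFin⁺ p w pw = Equivalence.to T-≡ (any⁺ p (tabulate⁺ w (Equivalence.from T-≡ pw)))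

any-allFin⁻ : (p : Fin n → Bool) → any p (allFin n) ≡ true → ∃ λ w → p w ≡ true
any-allFin⁻ {n} p e with w , pw ← tabulate⁻ (any⁻ p (allFin n) (Equivalence.from T-≡ e)) = w , Equivalence.to T-≡ pw

firstTrue-≥ : ∀ fuel p s → s ≤ firstTrue fuel p s
firstTrue-≥ zero p s = ≤-refl
firstTrue-≥ (suc fuel) p s with p s
... | true = ≤-refl
... | false = ≤-trans (n≤1+n s) (firstTrue-≥ fuel p (suc s))

firstTrue-≤ : ∀ fuel p s {k} → p k ≡ true → s ≤ k → firstTrue fuel p s ≤ k
firstTrue-≤ zero p s pk s≤k = s≤k
firstTrue-≤ (suc fuel) p s pk s≤k with p s in ps
... | true = s≤k
... | false with m≤n⇒m<n∨m≡n s≤k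
... | inj₁ s<k = firstTrue-≤ fuel p (suc s) pk s<k
... | inj₂ refl = contradiction ps (≡true⇒≢false pk)

firstTrue-> : ∀ fuel p s {k} → (∀ j → s ≤ j → j ≤ k → p j ≡ false) → k < s + fuel → k < firstTrue fuel p s
firstTrue-> zero p s p≡false k<s rewrite +-identityʳ s = k<s
firstTrue-> (suc fuel) p s {k} p≡false k<s+1+fuel with s ≤? k
... | no s≰k = ≤-trans (≰⇒> s≰k) (firstTrue-≥ (suc fuel) p s)
... | yes s≤k rewrite p≡false s ≤-refl s≤k =
  firstTrue-> fuel p (suc s) (λ j s<j j≤k → p≡false j (≤-trans (n≤1+n s) s<j) j≤k)
    (subst (k <_) (+-suc s fuel) k<s+1+fuel)

module _ (A : Adj n) where

  reach-refl : ∀ k u → reach A k u u ≡ true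
  reach-refl zero u = ==-refl u
  reach-refl (suc k) u rewrite reach-refl k u = refl

  reach-suc : ∀ k {u v} → reach A k u v ≡ true → reach A (suc k) u v ≡ true
  reach-suc k e rewrite e = refl

  reach-mono : ∀ {j k u v} → j ≤ k → reach A j u v ≡ true → reach A k u v ≡ true
  reach-mono {k = zero} z≤n e = e
  reach-mono {j} {suc k} j≤1+k e with m≤n⇒m<n∨m≡n j≤1+k
  ... | inj₁ (s≤s j≤k) = reach-suc k (reach-mono j≤k e)
  ... | inj₂ refl = e

  reach-step : ∀ k {u w v} → reach A k u w ≡ true → A w v ≡ true → reach A (suc k) u v ≡ true
  reach-step k {u} {w} {v} uw wv =
    trans (cong (reach A k u v ∨_) (any-allFin⁺ (λ z → reach A k u z ∧ A z v) w (cong₂ _∧_ uw wv)))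
          (∨-zeroʳ (reach A k u v))

  reach-zero⇒≡ : ∀ {u v} → reach A 0 u v ≡ true → u ≡ v
  reach-zero⇒≡ {u} = ==-true⇒≡ {u = u}

  reach-one : ∀ {u v} → A u v ≡ true → reach A 1 u v ≡ true
  reach-one {u} = reach-step 0 {u} (reach-refl 0 u)

  reach-two : ∀ {u w v} → A u w ≡ true → A w v ≡ true → reach A 2 u v ≡ true
  reach-two {u} uw = reach-step 1 {u} (reach-one uw)

  reach-one⇒≡⊎adjacent : ∀ {u v} → reach A 1 u v ≡ true → u ≡ v ⊎ A u v ≡ true
  reach-one⇒≡⊎adjacent {u} {v} e with ∨-true {reach A 0 u v} e
  ... | inj₁ u==v = inj₁ (reach-zero⇒≡ u==v)
  ... | inj₂ step with w , uw∧wv ← any-allFin⁻ (λ z → reach A 0 u z ∧ A z v) step =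
    inj₂ (subst (λ z → A z v ≡ true) (sym (reach-zero⇒≡ {u} (∧-trueˡ uw∧wv)))
                (∧-trueʳ {reach A 0 u w} uw∧wv))

  reach-one-false : ∀ {u v} → u ≢ v → A u v ≡ false → reach A 1 u v ≡ false
  reach-one-false u≢v uv =
    ¬-not λ e → [ u≢v , (λ uv′ → ≡true⇒≢false uv′ uv) ]′ (reach-one⇒≡⊎adjacent e)

  dist-≤ : ∀ k {u v} → reach A k u v ≡ true → dist A u v ≤ k
  dist-≤ k e = firstTrue-≤ n _ 0 e z≤n

  dist-> : ∀ k {u v} → reach A k u v ≡ false → k < n → k < dist A u v
  dist-> k {u} {v} e k<n = firstTrue-> n (λ j → reach A j u v) 0
    (λ j _ j≤k → ¬-not λ ej → ≡true⇒≢false (reach-mono j≤k ej) e) k<n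

  closer : Fin n → Fin n → Fin n → Bool
  closer x y u = dist A u x <ᵇ dist A u y

  Wcard≡count : ∀ x y → Wcard A x y ≡ count (closer x y)
  Wcard≡count x y = countV≡count (closer x y)

  closer-by-reach : ∀ k {x y u} → reach A k u x ≡ true → reach A k u y ≡ false → k < n → closer x y u ≡ true
  closer-by-reach k ux uy k<n = <⇒<ᵇ-true (≤-<-trans (dist-≤ k ux) (dist-> k uy k<n))

  not-closer-by-reach : ∀ k {x y u} → reach A k u x ≡ false → k < n → reach A (suc k) u y ≡ true →
                        closer x y u ≡ false
  not-closer-by-reach k ux k<n uy = ≥⇒<ᵇ-false (≤-trans (dist-≤ (suc k) uy) (dist-> k ux k<n))

  closer-self : ∀ {x y} → x ≢ y → closer x y x ≡ true
  closer-self {x} x≢y = closer-by-reach 0 (reach-refl 0 x) (≢⇒==-false x≢y) (≤-<-trans z≤n (toℕ<n x))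

  not-closer-other : ∀ x y → closer x y y ≡ false
  not-closer-other x y = ≥⇒<ᵇ-false (≤-trans (dist-≤ 0 (reach-refl 0 y)) z≤n)

  closer-neighbour : ∀ {x y u} → A u x ≡ true → u ≢ y → A u y ≡ false → closer x y u ≡ true
  closer-neighbour ux u≢y uy = closer-by-reach 1 (reach-one ux) (reach-one-false u≢y uy) (distinct⇒1<n u≢y)

  not-closer-neighbour : ∀ {x y u} → u ≢ x → A u y ≡ true → closer x y u ≡ false
  not-closer-neighbour {x} u≢x uy =
    not-closer-by-reach 0 (≢⇒==-false u≢x) (≤-<-trans z≤n (toℕ<n x)) (reach-one uy)

  not-closer-two-step : ∀ {x y u w} → u ≢ x → A u x ≡ false → A u w ≡ true → A w y ≡ true →
                        closer x y u ≡ false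
  not-closer-two-step u≢x ux uw wy = not-closer-by-reach 1 (reach-one-false u≢x ux) (distinct⇒1<n u≢x) (reach-two uw wy)

  constant-closer⇒distanceBalanced : (∀ x y → A x y ≡ A y x) → ∀ c →
    (∀ x y → A x y ≡ true → count (closer x y) ≡ c) → DistanceBalanced A
  constant-closer⇒distanceBalanced symmetric c closer≡c x y xy = begin
    Wcard A x y          ≡⟨ Wcard≡count x y ⟩
    count (closer x y)   ≡⟨ closer≡c x y xy ⟩
    c                    ≡⟨ closer≡c y x (trans (symmetric y x) xy) ⟨
    count (closer y x)   ≡⟨ Wcard≡count y x ⟨
    Wcard A y x          ∎
    where open ≡-Reasoning

  distanceBalanced⇒¬imbalance : DistanceBalanced A → ∀ {x y k} → A x y ≡ true →
    suc k ≤ count (closer x y) → count (closer y x) ≤ k → ⊥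
  distanceBalanced⇒¬imbalance balanced {x} {y} xy more fewer = 1+n≰n (begin
    suc _              ≤⟨ more ⟩
    count (closer x y) ≡⟨ Wcard≡count x y ⟨
    Wcard A x y        ≡⟨ balanced x y xy ⟩
    Wcard A y x        ≡⟨ Wcard≡count y x ⟩
    count (closer y x) ≤⟨ fewer ⟩
    _                  ∎)
    where open ≤-Reasoning

degree : Adj n → Fin n → ℕ
degree A v = count (A v)

edgeIndicator : Adj n → Fin n → Fin n → ℕ
edgeIndicator A i j = indicator ((toℕ i <ᵇ toℕ j) ∧ A i j)

edgeCount≡sumF : (A : Adj n) → edgeCount A ≡ sumF (λ i → sumF (edgeIndicator A i))
edgeCount≡sumF {n} A = begin
    edgeCount A
  ≡⟨ sum-concatMap row (allFin n) ⟩
    sum (map (sum ∘ row) (allFin n))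
  ≡⟨ sum-map-tabulate (λ i → i) (sum ∘ row) ⟩
    sumF (sum ∘ row)
  ≡⟨ sumF-cong (λ i → sum-map-tabulate (λ j → j) (edgeIndicator A i)) ⟩
    sumF (λ i → sumF (edgeIndicator A i))
  ∎
  where
  open ≡-Reasoning
  row : Fin n → List ℕ
  row i = map (edgeIndicator A i) (allFin n)

edgeIndicator-pair : (A : Adj n) → IsSimple A → ∀ i j → edgeIndicator A i j + edgeIndicator A j i ≡ indicator (A i j)
edgeIndicator-pair A (symmetric , loopless) i j
  rewrite symmetric j i with A i j in ij | <-cmp (toℕ i) (toℕ j)
... | false | _ rewrite ∧-zeroʳ (toℕ i <ᵇ toℕ j) | ∧-zeroʳ (toℕ j <ᵇ toℕ i) = refl
... | true | tri< i<j _ _ rewrite <⇒<ᵇ-true i<j | ≥⇒<ᵇ-false (<⇒≤ i<j) = refl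
... | true | tri> _ _ j<i rewrite <⇒<ᵇ-true j<i | ≥⇒<ᵇ-false (<⇒≤ j<i) = refl
... | true | tri≈ _ i≡j _ rewrite toℕ-injective i≡j = contradiction (loopless j) (≡true⇒≢false ij)

handshake : (A : Adj n) → IsSimple A → 2 * edgeCount A ≡ sumF (degree A)
handshake A simple = begin
    2 * edgeCount A
  ≡⟨ cong (2 *_) (edgeCount≡sumF A) ⟩
    E + (E + 0)
  ≡⟨ cong (λ s → E + s) (trans (+-identityʳ E) (sumF-swap (edgeIndicator A))) ⟩
    E + sumF (λ i → sumF (λ j → edgeIndicator A j i))
  ≡⟨ sumF-+ (λ i → sumF (edgeIndicator A i)) (λ i → sumF (λ j → edgeIndicator A j i)) ⟨
    sumF (λ i → sumF (edgeIndicator A i) + sumF (λ j → edgeIndicator A j i))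
  ≡⟨ sumF-cong (λ i → sumF-+ (edgeIndicator A i) (λ j → edgeIndicator A j i)) ⟨
    sumF (λ i → sumF (λ j → edgeIndicator A i j + edgeIndicator A j i))
  ≡⟨ sumF-cong (λ i → sumF-cong (edgeIndicator-pair A simple i)) ⟩
    sumF (degree A)
  ∎
  where
  open ≡-Reasoning
  E : ℕ
  E = sumF (λ i → sumF (edgeIndicator A i))

regular⇒edgeCount : (A : Adj n) → IsSimple A → ∀ d → (∀ v → degree A v ≡ d) → 2 * edgeCount A ≡ n * d
regular⇒edgeCount {n} A simple d regular = trans (handshake A simple) (trans (sumF-cong regular) (sumF-const {n} d))

degree-by-non-neighbours : (A : Adj n) (v : Fin n) → ∀ k → count (not ∘ A v) ≡ k → degree A v ≡ n ∸ k
degree-by-non-neighbours {n} A v k non≡k = begin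
    degree A v                                ≡⟨ m+n∸n≡m (degree A v) k ⟨
    degree A v + k ∸ k                        ≡⟨ cong (λ s → degree A v + s ∸ k) non≡k ⟨
    degree A v + count (not ∘ A v) ∸ k        ≡⟨ cong (_∸ k) (count-complement (A v)) ⟩
    n ∸ k                                     ∎
  where open ≡-Reasoning

degree≡n∸1 : (A : Adj n) → IsSimple A → ∀ v → (∀ u → A v u ≡ false → u ≡ v) → degree A v ≡ n ∸ 1
degree≡n∸1 A (_ , loopless) v non⊆v = degree-by-non-neighbours A v 1
  (≤-antisym (count≤1 v (λ u → non⊆v u ∘ not-true)) (count≥1 v (cong not (loopless v))))

degree≡n∸2 : (A : Adj n) → IsSimple A → ∀ v w → v ≢ w → A v w ≡ false →
             (∀ u → A v u ≡ false → u ≡ v ⊎ u ≡ w) → degree A v ≡ n ∸ 2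
degree≡n∸2 A (_ , loopless) v w v≢w vw non⊆vw = degree-by-non-neighbours A v 2
  (≤-antisym (count≤2 v w (λ u → non⊆vw u ∘ not-true)) (count≥2 v w (cong not (loopless v)) (cong not vw) v≢w))

adjacent⇒≢ : (A : Adj n) → IsSimple A → ∀ {u v} → A u v ≡ true → u ≢ v
adjacent⇒≢ A (_ , loopless) {u} uv refl = ≡true⇒≢false uv (loopless u)

complete : Adj n
complete u v = not (u == v)

complete-simple : IsSimple (complete {n})
complete-simple = (λ u v → cong not (==-sym u v)) , (λ u → cong not (==-refl u))

complete-adjacent : {u v : Fin n} → u ≢ v → complete u v ≡ true
complete-adjacent u≢v = cong not (≢⇒==-false u≢v)

count-closer-complete : {x y : Fin n} → complete x y ≡ true → count (closer complete x y) ≡ 1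
count-closer-complete {n} {x} {y} xy = ≤-antisym (count≤1 x closer⇒x) (count≥1 x (closer-self K {x} {y} x≢y))
  where
  K = complete {n}
  x≢y = adjacent⇒≢ K complete-simple xy
  closer⇒x : ∀ u → closer K x y u ≡ true → u ≡ x
  closer⇒x u closer-u with u ≟ x | u ≟ y
  ... | yes u≡x | _ = u≡x
  ... | no _ | yes refl = contradiction (not-closer-other K x u) (≡true⇒≢false closer-u)
  ... | no u≢x | no u≢y =
    contradiction (not-closer-neighbour K {x} {y} u≢x (complete-adjacent u≢y)) (≡true⇒≢false closer-u)

complete-distanceBalanced : DistanceBalanced (complete {n})
complete-distanceBalanced {n} = constant-closer⇒distanceBalanced complete (proj₁ complete-simple) 1
  (λ x y → count-closer-complete {n} {x} {y})

complete-edgeCount : ∀ n → 2 * edgeCount (complete {n}) ≡ n * (n ∸ 1)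
complete-edgeCount n = regular⇒edgeCount K complete-simple (n ∸ 1)
  (λ v → degree≡n∸1 K complete-simple v (λ u vu → sym (==-true⇒≡ {u = v} (not-false vu))))
  where K = complete {n}

-- K_n minus the pairs {u, v} with u + v = k: a perfect matching when n = k + 1 with k odd.
cocktailParty : ℕ → Adj n
cocktailParty k u v = not (u == v) ∧ not (toℕ u + toℕ v ≡ᵇ k)

cocktailParty-simple : ∀ k → IsSimple (cocktailParty {n} k)
cocktailParty-simple k =
  (λ u v → cong₂ (λ a b → not a ∧ not b) (==-sym u v) (cong (_≡ᵇ k) (+-comm (toℕ u) (toℕ v)))) ,
  (λ u → cong (λ a → not a ∧ not (toℕ u + toℕ u ≡ᵇ k)) (==-refl u))

module _ {k : ℕ} where

  cocktailParty-adjacent : {u v : Fin n} → u ≢ v → toℕ u + toℕ v ≢ k → cocktailParty k u v ≡ true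
  cocktailParty-adjacent u≢v sum≢k rewrite ≢⇒==-false u≢v | ≢⇒≡ᵇ-false sum≢k = refl

  cocktailParty-matched : {u v : Fin n} → toℕ u + toℕ v ≡ k → cocktailParty k u v ≡ false
  cocktailParty-matched {u = u} {v} sum≡k rewrite ≡⇒≡ᵇ-true sum≡k = ∧-zeroʳ (not (u == v))

  cocktailParty-unmatched : {u v : Fin n} → cocktailParty k u v ≡ true → toℕ u + toℕ v ≢ k
  cocktailParty-unmatched {u = u} {v} uv sum≡k = ≡true⇒≢false uv (cocktailParty-matched {u = u} {v} sum≡k)

  cocktailParty-non-adjacent : {u v : Fin n} → cocktailParty k u v ≡ false → u ≢ v → toℕ u + toℕ v ≡ k
  cocktailParty-non-adjacent {u = u} {v} uv u≢v with toℕ u + toℕ v ℕ.≟ k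
  ... | yes sum≡k = sum≡k
  ... | no sum≢k = contradiction (cocktailParty-adjacent u≢v sum≢k) (λ uv′ → ≡true⇒≢false uv′ uv)

module _ {k : ℕ} (n≡1+k : n ≡ suc k) (k-odd : ∀ t → t + t ≢ k) where

  private
    CP = cocktailParty {n} k

  partner : Fin n → Fin n
  partner y = fromℕ< (subst (k ∸ toℕ y <_) (sym n≡1+k) (s≤s (m∸n≤m k (toℕ y))))

  partner-sum : ∀ y → toℕ (partner y) + toℕ y ≡ k
  partner-sum y = trans (cong (_+ toℕ y) (toℕ-fromℕ< _))
                        (m∸n+n≡m (s≤s⁻¹ (subst (toℕ y <_) n≡1+k (toℕ<n y))))

  partner-unique : ∀ {u y} → toℕ u + toℕ y ≡ k → u ≡ partner y
  partner-unique {u} {y} sum≡k = toℕ-injective (+-cancelʳ-≡ (toℕ y) (toℕ u) _ (trans sum≡k (sym (partner-sum y))))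

  partner≢ : ∀ y → partner y ≢ y
  partner≢ y p≡y = k-odd (toℕ y) (subst (λ z → toℕ z + toℕ y ≡ k) p≡y (partner-sum y))

  ≢partner : ∀ {u y} → toℕ u + toℕ y ≢ k → u ≢ partner y
  ≢partner {y = y} u+y≢k refl = u+y≢k (partner-sum y)

  count-closer-cocktailParty : ∀ {x y} → CP x y ≡ true → count (closer CP x y) ≡ 2
  count-closer-cocktailParty {x} {y} xy =
    ≤-antisym (count≤2 x p closer⇒x∨p) (count≥2 x p (closer-self CP {x} {y} x≢y) p-closer x≢p)
    where
    p : Fin n
    p = partner y
    x≢y : x ≢ y
    x≢y = adjacent⇒≢ CP (cocktailParty-simple k) xy
    x≢p : x ≢ p
    x≢p = ≢partner (cocktailParty-unmatched {u = x} {y} xy)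
    p+x≢k : toℕ p + toℕ x ≢ k
    p+x≢k p+x≡k = x≢y (toℕ-injective (+-cancelˡ-≡ (toℕ p) _ _ (trans p+x≡k (sym (partner-sum y)))))
    p-closer : closer CP x y p ≡ true
    p-closer = closer-neighbour CP {x} {y} (cocktailParty-adjacent (x≢p ∘ sym) p+x≢k)
      (partner≢ y) (cocktailParty-matched {u = p} {y} (partner-sum y))
    closer⇒x∨p : ∀ u → closer CP x y u ≡ true → u ≡ x ⊎ u ≡ p
    closer⇒x∨p u closer-u with u ≟ x | toℕ u + toℕ y ℕ.≟ k | u ≟ y
    ... | yes u≡x | _ | _ = inj₁ u≡x
    ... | no _ | yes u+y≡k | _ = inj₂ (partner-unique u+y≡k)
    ... | no _ | no _ | yes refl = contradiction (not-closer-other CP x u) (≡true⇒≢false closer-u)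
    ... | no u≢x | no u+y≢k | no u≢y = contradiction
      (not-closer-neighbour CP {x} {y} u≢x (cocktailParty-adjacent u≢y u+y≢k)) (≡true⇒≢false closer-u)

  cocktailParty-distanceBalanced : DistanceBalanced CP
  cocktailParty-distanceBalanced = constant-closer⇒distanceBalanced CP (proj₁ (cocktailParty-simple k)) 2
    (λ x y → count-closer-cocktailParty {x} {y})

  cocktailParty-edgeCount : 2 * edgeCount CP ≡ n * (n ∸ 2)
  cocktailParty-edgeCount = regular⇒edgeCount CP (cocktailParty-simple k) (n ∸ 2) degree≡
    where
    degree≡ : ∀ v → degree CP v ≡ n ∸ 2
    degree≡ v = degree≡n∸2 CP (cocktailParty-simple k) v (partner v) (partner≢ v ∘ sym)
      (cocktailParty-matched {u = v} {partner v} (trans (+-comm (toℕ v) _) (partner-sum v))) non-neighbour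
      where
      non-neighbour : ∀ u → CP v u ≡ false → u ≡ v ⊎ u ≡ partner v
      non-neighbour u vu with u ≟ v
      ... | yes u≡v = inj₁ u≡v
      ... | no u≢v = inj₂ (partner-unique
        (trans (+-comm (toℕ u) (toℕ v)) (cocktailParty-non-adjacent vu (u≢v ∘ sym))))

module _ (H : Adj n) (simple : IsSimple H) (balanced : DistanceBalanced H) where

  universal⇒complete : ∀ o → (∀ u → u ≢ o → H o u ≡ true) → ∀ v u → u ≢ v → H v u ≡ true
  universal⇒complete o o-universal v u u≢v with v ≟ o
  ... | yes refl = o-universal u u≢v
  ... | no v≢o with H v u in vu
  ...   | true = refl
  ...   | false = ⊥-elim (distanceBalanced⇒¬imbalance H balanced ov more fewer)
    where
    symmetric = proj₁ simple
    ov : H o v ≡ true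
    ov = o-universal v v≢o
    u≢o : u ≢ o
    u≢o refl = ≡true⇒≢false (trans (symmetric v o) ov) vu
    more : 2 ≤ count (closer H o v)
    more = count≥2 o u (closer-self H {o} {v} (v≢o ∘ sym))
      (closer-neighbour H {o} {v} (trans (symmetric u o) (o-universal u u≢o)) u≢v (trans (symmetric u v) vu))
      (u≢o ∘ sym)
    fewer : count (closer H v o) ≤ 1
    fewer = count≤1 v closer⇒v
      where
      closer⇒v : ∀ w → closer H v o w ≡ true → w ≡ v
      closer⇒v w closer-w with w ≟ v | w ≟ o
      ... | yes w≡v | _ = w≡v
      ... | no _ | yes refl = contradiction (not-closer-other H v w) (≡true⇒≢false closer-w)
      ... | no w≢v | no w≢o = contradiction
        (not-closer-neighbour H {v} {o} w≢v (trans (symmetric w o) (o-universal w w≢o))) (≡true⇒≢false closer-w)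

  universal⇒edgeCount : ∀ o → (∀ u → u ≢ o → H o u ≡ true) → 2 * edgeCount H ≡ n * (n ∸ 1)
  universal⇒edgeCount o o-universal = regular⇒edgeCount H simple (n ∸ 1)
    (λ v → degree≡n∸1 H simple v λ u vu → decidable-stable (u ≟ v) λ u≢v →
      ≡true⇒≢false (universal⇒complete o o-universal v u u≢v) vu)

starE-true : ∀ m a b → starE m a b ≡ true → (a ≡ 0 × 1 ≤ b × b ≤ m) ⊎ (a ≡ 1 × b ≡ suc m)
starE-true m a b e with ∨-true {(a ≡ᵇ 0) ∧ ((1 ≤ᵇ b) ∧ (b ≤ᵇ m))} e
... | inj₁ o-x =
  inj₁ (≡ᵇ-true⇒≡ (∧-trueˡ o-x) , ≤ᵇ-true⇒≤ (∧-trueˡ bounds) , ≤ᵇ-true⇒≤ (∧-trueʳ {1 ≤ᵇ b} bounds))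
  where bounds = ∧-trueʳ {a ≡ᵇ 0} o-x
... | inj₂ x-y = inj₂ (≡ᵇ-true⇒≡ (∧-trueˡ x-y) , ≡ᵇ-true⇒≡ (∧-trueʳ {a ≡ᵇ 1} x-y))

starE-sum≢ : ∀ m a b → starE m a b ≡ true → a + b ≢ suc m
starE-sum≢ m a b e with starE-true m a b e
... | inj₁ (refl , _ , b≤m) = λ b≡1+m → 1+n≰n (subst (_≤ m) b≡1+m b≤m)
... | inj₂ (refl , refl) = λ 2+m≡1+m → 1+n≰n (≤-reflexive 2+m≡1+m)

starE-irreflexive : ∀ {m} → 1 ≤ m → ∀ a → starE m a a ≡ false
starE-irreflexive {m} 1≤m a = ¬-not λ e → irreflexive (starE-true m a a e)
  where
  irreflexive : (a ≡ 0 × 1 ≤ a × a ≤ m) ⊎ (a ≡ 1 × a ≡ suc m) → ⊥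
  irreflexive (inj₁ (a≡0 , 1≤a , _)) = 1+n≰n (subst (1 ≤_) a≡0 1≤a)
  irreflexive (inj₂ (a≡1 , a≡1+m)) = 1+n≰n (subst (1 ≤_) (sym (suc-injective (trans (sym a≡1) a≡1+m))) 1≤m)

S21-simple : ∀ {m} → 1 ≤ m → IsSimple (S21 m)
S21-simple {m} 1≤m =
  (λ i j → ∨-comm (starE m (toℕ i) (toℕ j)) _) ,
  (λ i → cong₂ _∨_ (starE-irreflexive 1≤m (toℕ i)) (starE-irreflexive 1≤m (toℕ i)))

S21⊆complete : ∀ {m} → 1 ≤ m → S21 m ⊆G complete
S21⊆complete {m} 1≤m i j ij = complete-adjacent (adjacent⇒≢ (S21 m) (S21-simple 1≤m) {i} {j} ij)

S21⊆cocktailParty : ∀ {m} → 1 ≤ m → S21 m ⊆G cocktailParty (suc m)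
S21⊆cocktailParty {m} 1≤m i j ij =
  cocktailParty-adjacent {u = i} {j} (adjacent⇒≢ (S21 m) (S21-simple 1≤m) {i} {j} ij) sum≢
  where
  sum≢ : toℕ i + toℕ j ≢ suc m
  sum≢ with ∨-true {starE m (toℕ i) (toℕ j)} ij
  ... | inj₁ e = starE-sum≢ m (toℕ i) (toℕ j) e
  ... | inj₂ e = starE-sum≢ m (toℕ j) (toℕ i) e ∘ trans (+-comm (toℕ j) (toℕ i))

sumℕ : ℕ → (ℕ → ℕ) → ℕ
sumℕ zero f = 0
sumℕ (suc n) f = f 0 + sumℕ n (f ∘ suc)

sumF∘toℕ : (f : ℕ → ℕ) → sumF {n} (f ∘ toℕ) ≡ sumℕ n f
sumF∘toℕ {zero} f = refl
sumF∘toℕ {suc n} f = cong (f 0 +_) (sumF∘toℕ {n} (f ∘ suc))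

sumℕ-cong : ∀ n {f g : ℕ → ℕ} → (∀ b → f b ≡ g b) → sumℕ n f ≡ sumℕ n g
sumℕ-cong zero f≗g = refl
sumℕ-cong (suc n) f≗g = cong₂ _+_ (f≗g 0) (sumℕ-cong n (f≗g ∘ suc))

sumℕ-zero : ∀ n {f : ℕ → ℕ} → (∀ b → f b ≡ 0) → sumℕ n f ≡ 0
sumℕ-zero n f≡0 = trans (sumℕ-cong n f≡0) (zeros n)
  where
  zeros : ∀ n → sumℕ n (λ _ → 0) ≡ 0
  zeros zero = refl
  zeros (suc n) = zeros n

sumℕ-<ᵇ : ∀ n h → h ≤ n → sumℕ n (λ b → indicator (b <ᵇ h)) ≡ h
sumℕ-<ᵇ n zero _ = sumℕ-zero n (λ _ → refl)
sumℕ-<ᵇ (suc n) (suc h) (s≤s h≤n) = cong suc (sumℕ-<ᵇ n h h≤n)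

sumℕ-≡ᵇ : ∀ n c → c < n → sumℕ n (λ b → indicator (b ≡ᵇ c)) ≡ 1
sumℕ-≡ᵇ (suc n) zero _ = cong suc (sumℕ-zero n (λ _ → refl))
sumℕ-≡ᵇ (suc n) (suc c) (s≤s c<n) = sumℕ-≡ᵇ n c c<n

starEdge : ℕ → ℕ → ℕ → ℕ
starEdge m a b = indicator ((a <ᵇ b) ∧ (starE m a b ∨ starE m b a))

starEdge-row-o : ∀ m → sumℕ (suc m) (starEdge m 0 ∘ suc) ≡ m
starEdge-row-o m = trans (sumℕ-cong (suc m) (λ b → cong indicator (o-x b))) (sumℕ-<ᵇ (suc m) m (n≤1+n m))
  where
  o-x : ∀ b → (((suc b ≤ᵇ m) ∨ false) ∨ ((b ≡ᵇ 0) ∧ false)) ≡ (b <ᵇ m)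
  o-x b rewrite ∨-identityʳ (suc b ≤ᵇ m) | ∧-zeroʳ (b ≡ᵇ 0) | ∨-identityʳ (suc b ≤ᵇ m) = refl

starEdge-row-x₁ : ∀ m → 1 ≤ m → sumℕ (2 + m) (starEdge m 1) ≡ 1
starEdge-row-x₁ (suc m) _ =
  trans (sumℕ-cong (suc m) (λ b → cong indicator (∨-identityʳ (b ≡ᵇ m)))) (sumℕ-≡ᵇ (suc m) m ≤-refl)

starEdge-row-later : ∀ m a b → starEdge m (2 + a) b ≡ 0
starEdge-row-later m a zero = refl
starEdge-row-later m a (suc zero) = refl
starEdge-row-later m a (suc (suc b)) = cong indicator (∧-zeroʳ _)

S21-edgeCount : ∀ m → 1 ≤ m → edgeCount (S21 m) ≡ m + 1
S21-edgeCount m 1≤m = begin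
    edgeCount (S21 m)
  ≡⟨ edgeCount≡sumF (S21 m) ⟩
    sumF {m + 2} (λ i → sumF {m + 2} (e (toℕ i) ∘ toℕ))
  ≡⟨ sumF-cong {m + 2} (λ i → sumF∘toℕ {m + 2} (e (toℕ i))) ⟩
    sumF {m + 2} ((λ a → sumℕ (m + 2) (e a)) ∘ toℕ)
  ≡⟨ sumF∘toℕ {m + 2} (λ a → sumℕ (m + 2) (e a)) ⟩
    sumℕ (m + 2) (λ a → sumℕ (m + 2) (e a))
  ≡⟨ cong (λ N → sumℕ N (λ a → sumℕ N (e a))) (+-comm m 2) ⟩
    e 0 0 + sumℕ (suc m) (e 0 ∘ suc) + (sumℕ (2 + m) (e 1) + sumℕ m (λ a → sumℕ (2 + m) (e (2 + a))))
  ≡⟨ cong₂ _+_ (starEdge-row-o m) (cong₂ _+_ (starEdge-row-x₁ m 1≤m)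
       (sumℕ-zero m (λ a → sumℕ-zero (2 + m) (starEdge-row-later m a)))) ⟩
    m + (1 + 0)
  ≡⟨ cong (m +_) (+-identityʳ 1) ⟩
    m + 1
  ∎
  where
  open ≡-Reasoning
  e = starEdge m

module DistanceBalancedSupergraph {m : ℕ} (1≤m : 1 ≤ m) (H : Adj (m + 2)) (simple : IsSimple H)
  (G⊆H : S21 m ⊆G H) (balanced : DistanceBalanced H) where

  private
    V = Fin (m + 2)
    symmetric = proj₁ simple
    imbalance = distanceBalanced⇒¬imbalance H balanced

    0<m+2 : 0 < m + 2
    0<m+2 = ≤-trans (s≤s z≤n) (m≤n+m 2 m)
    1<m+2 : 1 < m + 2
    1<m+2 = m≤n+m 2 m
    1+m<m+2 : suc m < m + 2
    1+m<m+2 = ≤-reflexive (+-comm 2 m)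

  o x₁ y : V
  o = fromℕ< 0<m+2
  x₁ = fromℕ< 1<m+2
  y = fromℕ< 1+m<m+2

  IsX : V → Set
  IsX u = 1 ≤ toℕ u × toℕ u ≤ m

  classify : ∀ u → u ≡ o ⊎ IsX u ⊎ u ≡ y
  classify u with toℕ u ℕ.≟ 0 | toℕ u ℕ.≟ suc m
  ... | yes u≡0 | _ = inj₁ (toℕ-injective (trans u≡0 (sym (toℕ-fromℕ< 0<m+2))))
  ... | no _ | yes u≡1+m = inj₂ (inj₂ (toℕ-injective (trans u≡1+m (sym (toℕ-fromℕ< 1+m<m+2)))))
  ... | no u≢0 | no u≢1+m = inj₂ (inj₁ (n≢0⇒n>0 u≢0 , s≤s⁻¹ (≤∧≢⇒< u≤1+m u≢1+m)))
    where
    u≤1+m : toℕ u ≤ suc m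
    u≤1+m = s≤s⁻¹ (subst (toℕ u <_) (+-comm m 2) (toℕ<n u))

  IsX-x₁ : IsX x₁
  IsX-x₁ = ≤-reflexive (sym (toℕ-fromℕ< 1<m+2)) , subst (_≤ m) (sym (toℕ-fromℕ< 1<m+2)) 1≤m

  IsX⇒≢o : ∀ {u} → IsX u → u ≢ o
  IsX⇒≢o (1≤u , _) refl = 1+n≰n (subst (1 ≤_) (toℕ-fromℕ< 0<m+2) 1≤u)

  IsX⇒≢y : ∀ {u} → IsX u → u ≢ y
  IsX⇒≢y (_ , u≤m) refl = 1+n≰n (subst (_≤ m) (toℕ-fromℕ< 1+m<m+2) u≤m)

  o≢y : o ≢ y
  o≢y o≡y = 0≢1+n (trans (sym (toℕ-fromℕ< 0<m+2)) (trans (cong toℕ o≡y) (toℕ-fromℕ< 1+m<m+2)))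

  o~X : ∀ {u} → IsX u → H o u ≡ true
  o~X {u} (1≤u , u≤m) = G⊆H o u S21-o-u
    where
    S21-o-u : S21 m o u ≡ true
    S21-o-u rewrite toℕ-fromℕ< 0<m+2 | ≤⇒≤ᵇ-true 1≤u | ≤⇒≤ᵇ-true u≤m = refl

  X~o : ∀ {u} → IsX u → H u o ≡ true
  X~o {u} X-u = trans (symmetric u o) (o~X X-u)

  x₁~y : H x₁ y ≡ true
  x₁~y = G⊆H x₁ y S21-x₁-y
    where
    S21-x₁-y : S21 m x₁ y ≡ true
    S21-x₁-y rewrite toℕ-fromℕ< 1<m+2 | toℕ-fromℕ< 1+m<m+2 | ≡⇒≡ᵇ-true {m} refl = refl

  o~y⇒o-universal : H o y ≡ true → ∀ u → u ≢ o → H o u ≡ true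
  o~y⇒o-universal o~y u u≢o with classify u
  ... | inj₁ u≡o = contradiction u≡o u≢o
  ... | inj₂ (inj₁ X-u) = o~X X-u
  ... | inj₂ (inj₂ refl) = o~y

  module _ (o≁y : H o y ≡ false) where

    private
      y≁o : H y o ≡ false
      y≁o = trans (symmetric y o) o≁y

    has-non-neighbour : ∀ v → ∃ λ w → w ≢ v × H v w ≡ false
    has-non-neighbour v with any? (λ w → ¬? (w ≟ v) ×-dec (H v w Bool.≟ false))
    ... | yes found = found
    ... | no none = contradiction (universal⇒complete H simple balanced v v-universal o y (o≢y ∘ sym))
                                  (λ o~y → ≡true⇒≢false o~y o≁y)
      where
      v-universal : ∀ u → u ≢ v → H v u ≡ true
      v-universal u u≢v = ¬-not λ v≁u → none (u , u≢v , v≁u)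

    x≁y⇒X-adjacent : ∀ {xᵢ xⱼ} → IsX xᵢ → H xᵢ y ≡ false → IsX xⱼ → xⱼ ≢ xᵢ → H xᵢ xⱼ ≡ true
    x≁y⇒X-adjacent {xᵢ} {xⱼ} X-xᵢ xᵢ≁y X-xⱼ xⱼ≢xᵢ with H xᵢ xⱼ in xᵢxⱼ
    ... | true = refl
    ... | false = ⊥-elim (imbalance (o~X X-xᵢ) more fewer)
      where
      more : 2 ≤ count (closer H o xᵢ)
      more = count≥2 o xⱼ (closer-self H {o} {xᵢ} (IsX⇒≢o X-xᵢ ∘ sym))
        (closer-neighbour H {o} {xᵢ} (X~o X-xⱼ) xⱼ≢xᵢ (trans (symmetric xⱼ xᵢ) xᵢxⱼ))
        (IsX⇒≢o X-xⱼ ∘ sym)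
      closer⇒xᵢ : ∀ w → closer H xᵢ o w ≡ true → w ≡ xᵢ
      closer⇒xᵢ w closer-w with w ≟ xᵢ | classify w
      ... | yes w≡xᵢ | _ = w≡xᵢ
      ... | no _ | inj₁ refl = contradiction (not-closer-other H xᵢ o) (≡true⇒≢false closer-w)
      ... | no w≢xᵢ | inj₂ (inj₁ X-w) =
        contradiction (not-closer-neighbour H {xᵢ} {o} w≢xᵢ (X~o X-w)) (≡true⇒≢false closer-w)
      ... | no w≢xᵢ | inj₂ (inj₂ refl) = contradiction
        (not-closer-two-step H {xᵢ} {o} w≢xᵢ (trans (symmetric y xᵢ) xᵢ≁y)
                                          (trans (symmetric y x₁) x₁~y) (X~o IsX-x₁))
        (≡true⇒≢false closer-w)
      fewer : count (closer H xᵢ o) ≤ 1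
      fewer = count≤1 xᵢ closer⇒xᵢ

    x~y⇒unique-non-neighbour : ∀ {xᵢ a b} → IsX xᵢ → H xᵢ y ≡ true → IsX a → IsX b → a ≢ xᵢ → b ≢ xᵢ →
                               H xᵢ a ≡ false → H xᵢ b ≡ false → a ≡ b
    x~y⇒unique-non-neighbour {xᵢ} {a} {b} X-xᵢ xᵢ~y X-a X-b a≢xᵢ b≢xᵢ xᵢ≁a xᵢ≁b with a ≟ b
    ... | yes a≡b = a≡b
    ... | no a≢b = ⊥-elim (imbalance (o~X X-xᵢ) more fewer)
      where
      more : 3 ≤ count (closer H o xᵢ)
      more = count≥3 o a b (closer-self H {o} {xᵢ} (IsX⇒≢o X-xᵢ ∘ sym))
        (closer-neighbour H {o} {xᵢ} (X~o X-a) a≢xᵢ (trans (symmetric a xᵢ) xᵢ≁a))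
        (closer-neighbour H {o} {xᵢ} (X~o X-b) b≢xᵢ (trans (symmetric b xᵢ) xᵢ≁b))
        (IsX⇒≢o X-a ∘ sym) (IsX⇒≢o X-b ∘ sym) a≢b
      closer⇒xᵢ∨y : ∀ w → closer H xᵢ o w ≡ true → w ≡ xᵢ ⊎ w ≡ y
      closer⇒xᵢ∨y w closer-w with w ≟ xᵢ | classify w
      ... | yes w≡xᵢ | _ = inj₁ w≡xᵢ
      ... | no _ | inj₁ refl = contradiction (not-closer-other H xᵢ o) (≡true⇒≢false closer-w)
      ... | no w≢xᵢ | inj₂ (inj₁ X-w) =
        contradiction (not-closer-neighbour H {xᵢ} {o} w≢xᵢ (X~o X-w)) (≡true⇒≢false closer-w)
      ... | no _ | inj₂ (inj₂ w≡y) = inj₂ w≡y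
      fewer : count (closer H xᵢ o) ≤ 2
      fewer = count≤2 xᵢ y closer⇒xᵢ∨y

    x~y⇒non-neighbour-IsX : ∀ {xᵢ w} → IsX xᵢ → H xᵢ y ≡ true → H xᵢ w ≡ false → IsX w
    x~y⇒non-neighbour-IsX {xᵢ} {w} X-xᵢ xᵢ~y xᵢ≁w with classify w
    ... | inj₁ refl = contradiction (X~o X-xᵢ) (λ xᵢ~o → ≡true⇒≢false xᵢ~o xᵢ≁w)
    ... | inj₂ (inj₁ X-w) = X-w
    ... | inj₂ (inj₂ refl) = contradiction xᵢ~y (λ xᵢ~y′ → ≡true⇒≢false xᵢ~y′ xᵢ≁w)

    X~y : ∀ {xⱼ} → IsX xⱼ → H xⱼ y ≡ true
    X~y {xⱼ} X-xⱼ with H xⱼ y in xⱼy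
    ... | true = refl
    ... | false = ⊥-elim (imbalance x₁~y more fewer)
      where
      p = proj₁ (has-non-neighbour x₁)
      p≢x₁ = proj₁ (proj₂ (has-non-neighbour x₁))
      x₁≁p = proj₂ (proj₂ (has-non-neighbour x₁))
      X-p = x~y⇒non-neighbour-IsX IsX-x₁ x₁~y x₁≁p
      x₁≢xⱼ : x₁ ≢ xⱼ
      x₁≢xⱼ refl = ≡true⇒≢false x₁~y xⱼy
      more : 3 ≤ count (closer H x₁ y)
      more = count≥3 x₁ o xⱼ (closer-self H {x₁} {y} (IsX⇒≢y IsX-x₁))
        (closer-neighbour H {x₁} {y} (o~X IsX-x₁) o≢y o≁y)
        (closer-neighbour H {x₁} {y} (x≁y⇒X-adjacent X-xⱼ xⱼy IsX-x₁ x₁≢xⱼ) (IsX⇒≢y X-xⱼ) xⱼy)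
        (IsX⇒≢o IsX-x₁) x₁≢xⱼ (IsX⇒≢o X-xⱼ ∘ sym)
      closer⇒y∨p : ∀ w → closer H y x₁ w ≡ true → w ≡ y ⊎ w ≡ p
      closer⇒y∨p w closer-w with w ≟ y | w ≟ p | w ≟ x₁ | classify w
      ... | yes w≡y | _ | _ | _ = inj₁ w≡y
      ... | no _ | yes w≡p | _ | _ = inj₂ w≡p
      ... | no _ | no _ | yes refl | _ = contradiction (not-closer-other H y x₁) (≡true⇒≢false closer-w)
      ... | no w≢y | no _ | no _ | inj₁ refl =
        contradiction (not-closer-neighbour H {y} {x₁} w≢y (o~X IsX-x₁)) (≡true⇒≢false closer-w)
      ... | no w≢y | no _ | no _ | inj₂ (inj₂ w≡y) = contradiction w≡y w≢y
      ... | no w≢y | no w≢p | no w≢x₁ | inj₂ (inj₁ X-w) with H w x₁ in wx₁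
      ...   | true = contradiction (not-closer-neighbour H {y} {x₁} w≢y wx₁) (≡true⇒≢false closer-w)
      ...   | false = contradiction
        (x~y⇒unique-non-neighbour IsX-x₁ x₁~y X-w X-p w≢x₁ p≢x₁ (trans (symmetric x₁ w) wx₁) x₁≁p) w≢p
      fewer : count (closer H y x₁) ≤ 2
      fewer = count≤2 y p closer⇒y∨p

    non-neighbours⊆ : ∀ v → ∃ λ w → w ≢ v × H v w ≡ false × (∀ u → H v u ≡ false → u ≡ v ⊎ u ≡ w)
    non-neighbours⊆ v with classify v
    ... | inj₁ refl = y , o≢y ∘ sym , o≁y , o-non-neighbour
      where
      o-non-neighbour : ∀ u → H o u ≡ false → u ≡ o ⊎ u ≡ y
      o-non-neighbour u o≁u with classify u
      ... | inj₁ u≡o = inj₁ u≡o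
      ... | inj₂ (inj₁ X-u) = contradiction (o~X X-u) (λ o~u → ≡true⇒≢false o~u o≁u)
      ... | inj₂ (inj₂ u≡y) = inj₂ u≡y
    ... | inj₂ (inj₂ refl) = o , o≢y , y≁o , y-non-neighbour
      where
      y-non-neighbour : ∀ u → H y u ≡ false → u ≡ y ⊎ u ≡ o
      y-non-neighbour u y≁u with classify u
      ... | inj₁ u≡o = inj₂ u≡o
      ... | inj₂ (inj₁ X-u) = contradiction (trans (symmetric y u) (X~y X-u)) (λ y~u → ≡true⇒≢false y~u y≁u)
      ... | inj₂ (inj₂ u≡y) = inj₁ u≡y
    ... | inj₂ (inj₁ X-v) = w , w≢v , v≁w , x-non-neighbour
      where
      w = proj₁ (has-non-neighbour v)
      w≢v = proj₁ (proj₂ (has-non-neighbour v))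
      v≁w = proj₂ (proj₂ (has-non-neighbour v))
      x-non-neighbour : ∀ u → H v u ≡ false → u ≡ v ⊎ u ≡ w
      x-non-neighbour u v≁u with u ≟ v | classify u
      ... | yes u≡v | _ = inj₁ u≡v
      ... | no _ | inj₁ refl = contradiction (X~o X-v) (λ v~o → ≡true⇒≢false v~o v≁u)
      ... | no _ | inj₂ (inj₂ refl) = contradiction (X~y X-v) (λ v~y → ≡true⇒≢false v~y v≁u)
      ... | no u≢v | inj₂ (inj₁ X-u) = inj₂ (x~y⇒unique-non-neighbour X-v (X~y X-v)
        X-u (x~y⇒non-neighbour-IsX X-v (X~y X-v) v≁w) u≢v w≢v v≁u v≁w)

    cocktail-regular : ∀ v → degree H v ≡ m + 2 ∸ 2
    cocktail-regular v with w , w≢v , v≁w , non⊆ ← non-neighbours⊆ v =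
      degree≡n∸2 H simple v w (w≢v ∘ sym) v≁w non⊆

  edgeCount-dichotomy : 2 * edgeCount H ≡ (m + 2) * (m + 1) ⊎ 2 * edgeCount H ≡ (m + 2) * m
  edgeCount-dichotomy with H o y in o-y
  ... | true = inj₁ (trans (universal⇒edgeCount H simple balanced o (o~y⇒o-universal o-y))
                           (cong ((m + 2) *_) (+-∸-assoc m {2} {1} (s≤s z≤n))))
  ... | false = inj₂ (trans (regular⇒edgeCount H simple (m + 2 ∸ 2) (cocktail-regular o-y))
                            (cong ((m + 2) *_) (m+n∸n≡m m 2)))

isB-from-doubled-edgeCounts : {G K : Adj n} (k : ℕ) → IsSimple K → G ⊆G K → DistanceBalanced K →
  2 * edgeCount K ≡ 2 * (k + edgeCount G) →
  (∀ H → IsSimple H → G ⊆G H → DistanceBalanced H → 2 * (k + edgeCount G) ≤ 2 * edgeCount H) →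
  IsB G k
isB-from-doubled-edgeCounts {G = G} {K} k simple-K G⊆K balanced-K K-edges minimal =
  (K , simple-K , G⊆K , balanced-K ,
     trans (cong (_∸ e) (*-cancelˡ-≡ (edgeCount K) (k + e) 2 K-edges)) (m+n∸n≡m k e)) ,
  λ H simple-H G⊆H balanced-H → ≤-trans (≤-reflexive (sym (m+n∸n≡m k e)))
    (∸-monoˡ-≤ e (*-cancelˡ-≤ 2 (minimal H simple-H G⊆H balanced-H)))
  where
  e = edgeCount G

2*[1+n]C2≡[1+n]*n : ∀ n → 2 * (suc n C 2) ≡ suc n * n
2*[1+n]C2≡[1+n]*n zero = refl
2*[1+n]C2≡[1+n]*n (suc n) = begin
    2 * (suc (suc n) C 2)            ≡⟨ cong (2 *_) (nCk+nC[k+1]≡[n+1]C[k+1] (suc n) 1) ⟨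
    2 * (suc n C 1 + suc n C 2)      ≡⟨ cong (λ c → 2 * (c + suc n C 2)) (nC1≡n (suc n)) ⟩
    2 * (suc n + suc n C 2)          ≡⟨ *-distribˡ-+ 2 (suc n) (suc n C 2) ⟩
    2 * suc n + 2 * (suc n C 2)      ≡⟨ cong (2 * suc n +_) (2*[1+n]C2≡[1+n]*n n) ⟩
    2 * suc n + suc n * n
      ≡⟨ solve 1 (λ n → con 2 :* (con 1 :+ n) :+ (con 1 :+ n) :* n := (con 2 :+ n) :* (con 1 :+ n)) refl n ⟩
    suc (suc n) * suc n              ∎
  where open ≡-Reasoning

m%2≡0⇒m≡2*[m/2] : ∀ m → m % 2 ≡ 0 → m ≡ 2 * (m / 2)
m%2≡0⇒m≡2*[m/2] m m%2≡0 =
  trans (m≡m%n+[m/n]*n m 2) (trans (cong (_+ m / 2 * 2) m%2≡0) (*-comm (m / 2) 2))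

m%2≡1⇒m≡1+2*[m/2] : ∀ m → m % 2 ≡ 1 → m ≡ suc (2 * (m / 2))
m%2≡1⇒m≡1+2*[m/2] m m%2≡1 =
  trans (m≡m%n+[m/n]*n m 2) (trans (cong (_+ m / 2 * 2) m%2≡1) (cong suc (*-comm (m / 2) 2)))

2*[m*m/2∸1+[m+1]]≡[m+2]*m : ∀ m → 2 ≤ m → m % 2 ≡ 0 → 2 * (m * m / 2 ∸ 1 + (m + 1)) ≡ (m + 2) * m
2*[m*m/2∸1+[m+1]]≡[m+2]*m m 2≤m m%2≡0 = begin
    2 * (h ∸ 1 + (m + 1))       ≡⟨ cong (2 *_) (trans (cong (h ∸ 1 +_) (+-comm m 1)) (sym (+-assoc (h ∸ 1) 1 m))) ⟩
    2 * (h ∸ 1 + 1 + m)         ≡⟨ cong (λ h′ → 2 * (h′ + m)) (m∸n+n≡m 1≤h) ⟩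
    2 * (h + m)                 ≡⟨ cong (λ h′ → 2 * (h′ + m)) h≡q*m ⟩
    2 * (q * m + m)             ≡⟨ solve 2 (λ q m → con 2 :* (q :* m :+ m) := (con 2 :* q :+ con 2) :* m) refl q m ⟩
    (2 * q + 2) * m             ≡⟨ cong (λ m′ → (m′ + 2) * m) m≡2q ⟨
    (m + 2) * m                 ∎
  where
  open ≡-Reasoning
  q = m / 2
  h = m * m / 2
  m≡2q = m%2≡0⇒m≡2*[m/2] m m%2≡0
  h≡q*m : h ≡ q * m
  h≡q*m = trans (cong (_/ 2) (trans (cong (_* m) m≡2q)
                                    (solve 2 (λ q m → (con 2 :* q) :* m := (q :* m) :* con 2) refl q m)))
                (m*n/n≡m (q * m) 2)
  1≤q : 1 ≤ q
  1≤q with q | m≡2q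
  ... | zero | m≡0 = contradiction (subst (2 ≤_) m≡0 2≤m) λ ()
  ... | suc _ | _ = s≤s z≤n
  1≤h : 1 ≤ h
  1≤h = subst (1 ≤_) (sym h≡q*m) (*-mono-≤ 1≤q (≤-trans (s≤s z≤n) 2≤m))

2*[[m+1]C2+[m+1]]≡[m+2]*[m+1] : ∀ m → 2 * ((m + 1) C 2 + (m + 1)) ≡ (m + 2) * (m + 1)
2*[[m+1]C2+[m+1]]≡[m+2]*[m+1] m = begin
    2 * ((m + 1) C 2 + (m + 1))          ≡⟨ *-distribˡ-+ 2 ((m + 1) C 2) (m + 1) ⟩
    2 * ((m + 1) C 2) + 2 * (m + 1)      ≡⟨ cong (λ n → 2 * (n C 2) + 2 * n) (+-comm m 1) ⟩
    2 * (suc m C 2) + 2 * suc m          ≡⟨ cong (_+ 2 * suc m) (2*[1+n]C2≡[1+n]*n m) ⟩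
    suc m * m + 2 * suc m
      ≡⟨ solve 1 (λ m → (con 1 :+ m) :* m :+ con 2 :* (con 1 :+ m) := (m :+ con 2) :* (m :+ con 1)) refl m ⟩
    (m + 2) * (m + 1)                    ∎
  where open ≡-Reasoning

m%2≡1⇒2*e≢[m+2]*m : ∀ m → m % 2 ≡ 1 → ∀ e → 2 * e ≢ (m + 2) * m
m%2≡1⇒2*e≢[m+2]*m m m%2≡1 e 2e≡ = even≢odd e (2 * q * q + 4 * q + 1) (begin
    2 * e                                   ≡⟨ 2e≡ ⟩
    (m + 2) * m                             ≡⟨ cong (λ m′ → (m′ + 2) * m′) (m%2≡1⇒m≡1+2*[m/2] m m%2≡1) ⟩
    (suc (2 * q) + 2) * suc (2 * q)         ≡⟨ solve 1 (λ q → (con 1 :+ con 2 :* q :+ con 2) :* (con 1 :+ con 2 :* q)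
                                                  := con 1 :+ con 2 :* (con 2 :* q :* q :+ con 4 :* q :+ con 1)) refl q ⟩
    suc (2 * (2 * q * q + 4 * q + 1))       ∎)
  where
  open ≡-Reasoning
  q = m / 2

IsB-S21-even : ∀ m → 2 ≤ m → m % 2 ≡ 0 → IsB (S21 m) (m * m / 2 ∸ 1)
IsB-S21-even m 2≤m m%2≡0 = isB-from-doubled-edgeCounts k (cocktailParty-simple (suc m)) (S21⊆cocktailParty 1≤m)
    (cocktailParty-distanceBalanced m+2≡2+m 1+m-odd) (trans cocktail-edges (sym target)) minimal
  where
  k = m * m / 2 ∸ 1
  1≤m = ≤-trans (s≤s z≤n) 2≤m
  m+2≡2+m = +-comm m 2
  1+m-odd : ∀ t → t + t ≢ suc m
  1+m-odd t t+t≡1+m = even≢odd t (m / 2)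
    (trans (cong (t +_) (*-identityˡ t)) (trans t+t≡1+m (cong suc (m%2≡0⇒m≡2*[m/2] m m%2≡0))))
  target : 2 * (k + edgeCount (S21 m)) ≡ (m + 2) * m
  target = trans (cong (λ e → 2 * (k + e)) (S21-edgeCount m 1≤m)) (2*[m*m/2∸1+[m+1]]≡[m+2]*m m 2≤m m%2≡0)
  cocktail-edges = trans (cocktailParty-edgeCount m+2≡2+m 1+m-odd) (cong ((m + 2) *_) (m+n∸n≡m m 2))
  minimal : ∀ H → IsSimple H → S21 m ⊆G H → DistanceBalanced H → 2 * (k + edgeCount (S21 m)) ≤ 2 * edgeCount H
  minimal H simple G⊆H balanced with DistanceBalancedSupergraph.edgeCount-dichotomy 1≤m H simple G⊆H balanced
  ... | inj₁ complete-like = ≤-trans (≤-reflexive target) (≤-trans (*-monoʳ-≤ (m + 2) (m≤m+n m 1))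
                                                                    (≤-reflexive (sym complete-like)))
  ... | inj₂ cocktail-like = ≤-reflexive (trans target (sym cocktail-like))

IsB-S21-odd : ∀ m → 1 ≤ m → m % 2 ≡ 1 → IsB (S21 m) ((m + 1) C 2)
IsB-S21-odd m 1≤m m%2≡1 = isB-from-doubled-edgeCounts k complete-simple (S21⊆complete 1≤m) complete-distanceBalanced
    (trans complete-edges (sym target)) minimal
  where
  k = (m + 1) C 2
  target : 2 * (k + edgeCount (S21 m)) ≡ (m + 2) * (m + 1)
  target = trans (cong (λ e → 2 * (k + e)) (S21-edgeCount m 1≤m)) (2*[[m+1]C2+[m+1]]≡[m+2]*[m+1] m)
  complete-edges = trans (complete-edgeCount (m + 2)) (cong ((m + 2) *_) (+-∸-assoc m {2} {1} (s≤s z≤n)))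
  minimal : ∀ H → IsSimple H → S21 m ⊆G H → DistanceBalanced H → 2 * (k + edgeCount (S21 m)) ≤ 2 * edgeCount H
  minimal H simple G⊆H balanced with DistanceBalancedSupergraph.edgeCount-dichotomy 1≤m H simple G⊆H balanced
  ... | inj₁ complete-like = ≤-reflexive (trans target (sym complete-like))
  ... | inj₂ cocktail-like = contradiction cocktail-like (m%2≡1⇒2*e≢[m+2]*m m m%2≡1 (edgeCount H))

theorem3p3 : (m : ℕ) → 3 ≤ m →
    (m % 2 ≡ 0 → IsB (S21 m) (m * m / 2 ∸ 1))
    × (m % 2 ≡ 1 → IsB (S21 m) ((m + 1) C 2))
theorem3p3 m 3≤m = IsB-S21-even m (≤-trans (n≤1+n 2) 3≤m) , IsB-S21-odd m (≤-trans (s≤s z≤n) 3≤m)
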